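{- Let $n$ be a positive integer and $m=\lceil\frac n3\rceil$. The set $$\{\gamma(U_{2n-1})\}\cup\{\gamma\rho(\nabla B^{2k+1}_{2n-1,k-n+1}): k\in\{0,\dots,m-2\}\}$$ is a basis of $\mathcal{DPT}(n)$. Here $\gamma(U_{2n-1})$ is the generalized Pascal triangle whose left and right sides both equal $(1)\cdot(0)_{n-2}\cdot(1)$, and for all $k\in\{0,\dots,m-2\}$, $$\gamma\rho(\nabla B^{2k+1}_{2n-1,k-n+1})=\left(\binom{k+j-i}{2k-i+2}+\binom{k-j+1}{i-j+2k-n+2}+\binom{k-n+i}{2k+j-n+1}\bmod 2\right)_{1\le j\le i\le n}.$$
   Context: Binomial coefficients $\binom{a}{b}$ are defined for all integers $a,b$ by $\binom{a}{0}=1$, $\binom{0}{b}=0$ for $b>0$, and $\binom{a}{b}=\binom{a-1}{b-1}+\binom{a-1}{b}$ for all $a,b\in\mathbb{Z}$. A binary Steinhaus triangle of size $N$ is an array $(a_{i,j})_{1\le i\le j\le N}$ of elements of $\{0,1\}$ with $a_{i,j}\equiv a_{i-1,j-1}+a_{i-1,j}\pmod 2$ for $2\le i\le j\le N$. $\nabla S$ is the triangle with first row $S$. On these triangles, $r((a_{i,j}))=(a_{j-i+1,N-i+1})$, $\rho=r^2+r+\mathrm{id}$, and $U_N=\rho(\nabla(1)_N)$. A generalized Pascal triangle of size $n$ is an array $(a_{i,j})_{1\le j\le i\le n}$ of elements of $\{0,1\}$ with $a_{i,j}\equiv a_{i-1,j-1}+a_{i-1,j}\pmod 2$ for $2\le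 j<i\le n$. Its left side is $(a_{i,1})_i$ and its right side is $(a_{i,i})_i$. These form a vector space $\mathcal{PT}(n)$ over $\mathbb{Z}/2\mathbb{Z}$. The map $\gamma$ sends a Steinhaus triangle $(a_{i,j})$ of size $2n-1$ to $(a_{i,n-1+j})_{1\le j\le i\le n}$. On $\mathcal{PT}(n)$, $r'((a_{i,j}))=(a_{n+j-i,n+1-i})$ and $h'((a_{i,j}))=(a_{i,1-j+i})$, and $\mathcal{DPT}(n)=\{\Delta: r'(\Delta)=h'(\Delta)=\Delta\}$. $B^{k}_{N,l}=\left(\binom{l+j-1}{k}\bmod 2\right)_{1\le j\le N}$. $(x)_k$ is the constant sequence of length $k$ equal to $x$, and $\cdot$ is concatenation. -}

module Defs where

open import Data.Bool using (Bool; true; false; _xor_; _∧_; _∨_; if_then_else_)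
open import Data.Nat using (ℕ; zero; suc; _+_; _*_; _∸_; _≤_; _<_; _≡ᵇ_; _%_; _/_)
open import Data.Product using (_×_; Σ)
open import Data.Nat.Combinatorics using (_C_)
open import Data.Integer as ℤ using (ℤ; +_; -[1+_]; ∣_∣)
open import Data.Fin using (Fin; toℕ)
open import Relation.Binary.PropositionalEquality using (_≡_)

-- The recursive definition of the paper (C(a,0)=1, C(0,b)=0 for b>0,
-- Pascal's rule for all a,b) has the unique solution
--   C(a,b) = 0                               for b < 0
--   C(a,b) = a C b                           for a ≥ 0, b ≥ 0
--   C(-(m+1),b) = (-1)^b (m+b) C b           for a < 0, b ≥ 0

binomℤ : ℤ → ℤ → ℤ
binomℤ a -[1+ _ ] = + 0
binomℤ (+ n) (+ k) = + (n C k)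
binomℤ -[1+ m ] (+ k) = (ℤ.- (+ 1)) ℤ.^ k ℤ.* + ((m + k) C k)

-- reduction mod 2 into Z/2Z = Bool (true = 1, xor = +)
mod2 : ℤ → Bool
mod2 z = (∣ z ∣ % 2) ≡ᵇ 1

-- Sequences (indexed from 1) and triangles (indexed by (i , j), both
-- from 1).  Only entries inside the relevant index domain matter.

Seq : Set
Seq = ℕ → Bool

Tri : Set
Tri = ℕ → ℕ → Bool

-- constant sequence (x)_k  (length is implicit in context)
const : Bool → Seq
const x _ = x

B : ℕ → ℤ → Seq
B k l j = mod2 (binomℤ (l ℤ.+ + j ℤ.- + 1) (+ k))

-- Binary Steinhaus triangles of size N: indices 1 ≤ i ≤ j ≤ N.

∇ : Seq → Tri
∇ S zero j = false
∇ S (suc zero) j = S j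
∇ S (suc (suc i)) j = ∇ S (suc i) (j ∸ 1) xor ∇ S (suc i) j

r : ℕ → Tri → Tri
r N a i j = a (j ∸ i + 1) (N ∸ i + 1)

_⊕_ : Tri → Tri → Tri
(a ⊕ b) i j = a i j xor b i j

ρ : ℕ → Tri → Tri
ρ N a = (r N (r N a) ⊕ r N a) ⊕ a

U : ℕ → Tri
U N = ρ N (∇ (const true))

γ : ℕ → Tri → Tri
γ n a i j = a i (n ∸ 1 + j)

-- Generalized Pascal triangles of size n: indices 1 ≤ j ≤ i ≤ n.

_≈[_]_ : Tri → ℕ → Tri → Set
a ≈[ n ] b = ∀ i j → 1 ≤ j → j ≤ i → i ≤ n → a i j ≡ b i j

IsPT : ℕ → Tri → Set
IsPT n a = ∀ i j → 2 ≤ j → j < i → i ≤ n →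
           a i j ≡ (a (i ∸ 1) (j ∸ 1) xor a (i ∸ 1) j)

r′ : ℕ → Tri → Tri
r′ n a i j = a (n + j ∸ i) (n + 1 ∸ i)

h′ : Tri → Tri
h′ a i j = a i (1 + i ∸ j)

IsDPT : ℕ → Tri → Set
IsDPT n a = IsPT n a × ((r′ n a ≈[ n ] a) × (h′ a ≈[ n ] a))

zeroTri : Tri
zeroTri _ _ = false

lincomb : ∀ {m} → (Fin m → Bool) → (Fin m → Tri) → Tri
lincomb {zero} c v i j = false
lincomb {suc m} c v i j =
  (c Fin.zero ∧ v Fin.zero i j) xor lincomb (λ t → c (Fin.suc t)) (λ t → v (Fin.suc t)) i j
  where import Data.Fin as Fin

LinIndep : ℕ → ∀ {m} → (Fin m → Tri) → Set
LinIndep n {m} v = (c : Fin m → Bool) → lincomb c v ≈[ n ] zeroTri → ∀ t → c t ≡ false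

Spans : ℕ → (Tri → Set) → ∀ {m} → (Fin m → Tri) → Set
Spans n P {m} v = ∀ a → P a → Σ (Fin m → Bool) (λ c → a ≈[ n ] lincomb c v)

IsBasis : ℕ → (Tri → Set) → ∀ {m} → (Fin m → Tri) → Set
IsBasis n P v = (∀ t → P (v t)) × (LinIndep n v × Spans n P v)

ceil/3 : ℕ → ℕ
ceil/3 n = (n + 2) / 3

gen : ℕ → ℕ → Tri
gen n k = γ n (ρ (2 * n ∸ 1) (∇ (B (2 * k + 1) (+ k ℤ.- + n ℤ.+ + 1))))

family : ℕ → ℕ → Tri
family n zero = γ n (U (2 * n ∸ 1))
family n (suc k) = gen n k

side : ℕ → Seq
side n i = (i ≡ᵇ 1) ∨ (i ≡ᵇ n)

explicit : ℕ → ℕ → Tri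
explicit n k i j = mod2
  ( binomℤ (+ k ℤ.+ + j ℤ.- + i) (+ (2 * k) ℤ.- + i ℤ.+ + 2)
  ℤ.+ binomℤ (+ k ℤ.- + j ℤ.+ + 1) (+ i ℤ.- + j ℤ.+ + (2 * k) ℤ.- + n ℤ.+ + 2)
  ℤ.+ binomℤ (+ k ℤ.- + n ℤ.+ + i) (+ (2 * k) ℤ.+ + j ℤ.- + n ℤ.+ + 1))

module Submission where

-- The entry (i, j) of a triangle of size n is indexed by the point (x, y, z) = (j-1, i-j, n-i)
-- of the simplex x + y + z = n - 1.  A triangle lies in DPT(n) iff its coordinate function is
-- invariant under all permutations of (x, y, z) and satisfies Pascal's rule.  The proof has
-- three parts:
--  1. Rigidity: such a function that vanishes at the first m points of an edge vanishes,
--     because n ≤ 3m; so the first m entries of the left side determine an element of DPT(n).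
--  2. Echelon lemma: m elements of DPT(n) whose left sides are in echelon form are a basis.
--  3. In coordinates γρ(∇S) is a cyclic sum g(z,y) + g(x,z) + g(y,x) of entries of ∇S.  For the
--     family, g(p,q) is [p + q = 0] or T_k(p,q) = C(k-p, 2k+1-p-q) mod 2; both are symmetric and
--     satisfy a Pascal-type rule, which makes the cyclic sum doubly symmetric.  Evaluating the
--     cyclic sums on the left side gives the echelon form, the sides of γ(U_{2n-1}) and the
--     explicit formula.
-- Binomial coefficients on ℤ are handled modulo 2 throughout, via Pascal's rule and upper
-- negation.

open import Defs
open import Algebra.Solver.Ring.AlmostCommutativeRing using (fromCommutativeRing)
import Algebra.Solver.Ring.Simple
open import Data.Bool using (Bool; true; false; _xor_; not; _∧_; _∨_; _≟_)
open import Data.Bool.Properties using (not-involutive; xor-assoc; xor-comm; xor-same; ∧-identityʳ; ∧-zeroʳ; xor-∧-commutativeRing)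
open import Data.Empty using (⊥-elim)
open import Data.Fin as Fin using (Fin; toℕ)
import Data.Fin.Properties as FinP
open import Data.Integer as ℤ using (ℤ; +_; -[1+_]; ∣_∣; _⊖_)
import Data.Integer.Properties as ℤP
import Data.Integer.Tactic.RingSolver as ℤSolver
open import Data.Nat as ℕ using (ℕ; zero; suc; _+_; _*_; _∸_; _≤_; _<_; z≤n; s≤s; _%_; _≡ᵇ_)
open import Data.Nat.Combinatorics using (_C_; nCk+nC[k+1]≡[n+1]C[k+1]; k>n⇒nCk≡0)
open import Data.Nat.DivMod using ([m+n]%n≡m%n; m≡m%n+[m/n]*n; m%n<n; m/n*n≤m)
import Data.Nat.Properties as ℕP
import Data.Nat.Tactic.RingSolver as ℕSolver
open import Data.Product using (_×_; _,_; proj₁; proj₂; Σ)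
open import Data.Sum using (inj₁; inj₂)
open import Function using (_∘_)
open import Relation.Binary using (tri<; tri≈; tri>)
open import Relation.Binary.PropositionalEquality
open import Relation.Nullary using (yes; no; does)

module 𝔽₂ = Algebra.Solver.Ring.Simple (fromCommutativeRing xor-∧-commutativeRing) _≟_

parity : ℕ → Bool
parity zero = false
parity (suc n) = not (parity n)

parity-+ : ∀ m n → parity (m + n) ≡ parity m xor parity n
parity-+ zero n = refl
parity-+ (suc m) n = trans (cong not (parity-+ m n)) (sym (xor-assoc true (parity m) (parity n)))

mod2≡parity : ∀ z → mod2 z ≡ parity ∣ z ∣
mod2≡parity z = go ∣ z ∣
  where
  go : ∀ n → (n % 2 ≡ᵇ 1) ≡ parity n
  go zero = refl
  go (suc zero) = refl
  go (suc (suc n)) = begin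
    (suc (suc n) % 2 ≡ᵇ 1) ≡⟨ cong (_≡ᵇ 1) (trans (cong (_% 2) (ℕP.+-comm 2 n)) ([m+n]%n≡m%n n 2)) ⟩
    (n % 2 ≡ᵇ 1)           ≡⟨ go n ⟩
    parity n               ≡⟨ not-involutive (parity n) ⟨
    parity (suc (suc n))   ∎
    where open ≡-Reasoning

parity-⊖ : ∀ m n → parity ∣ m ⊖ n ∣ ≡ parity m xor parity n
parity-⊖ zero zero = refl
parity-⊖ zero (suc n) = refl
parity-⊖ (suc m) zero = sym (xor-comm (parity (suc m)) false)
parity-⊖ (suc m) (suc n) = begin
  parity ∣ suc m ⊖ suc n ∣          ≡⟨ cong (λ z → parity ∣ z ∣) (ℤP.[1+m]⊖[1+n]≡m⊖n m n) ⟩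
  parity ∣ m ⊖ n ∣                  ≡⟨ parity-⊖ m n ⟩
  parity m xor parity n             ≡⟨ 𝔽₂.solve 2 (λ a b → a :+ b := (con true :+ a) :+ (con true :+ b)) refl (parity m) (parity n) ⟩
  not (parity m) xor not (parity n) ∎
  where open ≡-Reasoning; open 𝔽₂

mod2-+ : ∀ a b → mod2 (a ℤ.+ b) ≡ mod2 a xor mod2 b
mod2-+ a b = begin
  mod2 (a ℤ.+ b)              ≡⟨ mod2≡parity (a ℤ.+ b) ⟩
  parity ∣ a ℤ.+ b ∣          ≡⟨ abs-+ a b ⟩
  parity ∣ a ∣ xor parity ∣ b ∣ ≡⟨ cong₂ _xor_ (mod2≡parity a) (mod2≡parity b) ⟨
  mod2 a xor mod2 b           ∎
  where
  open ≡-Reasoning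
  open 𝔽₂
  abs-+ : ∀ a b → parity ∣ a ℤ.+ b ∣ ≡ parity ∣ a ∣ xor parity ∣ b ∣
  abs-+ (+ m) (+ n) = parity-+ m n
  abs-+ (+ m) -[1+ n ] = parity-⊖ m (suc n)
  abs-+ -[1+ m ] (+ n) = trans (parity-⊖ n (suc m)) (xor-comm (parity n) _)
  abs-+ -[1+ m ] -[1+ n ] = trans (cong (λ p → not (not p)) (parity-+ m n))
    (solve 2 (λ a b → con true :+ (con true :+ (a :+ b)) := (con true :+ a) :+ (con true :+ b)) refl (parity m) (parity n))

binomBit : ℕ → ℕ → Bool
binomBit n zero = true
binomBit zero (suc k) = false
binomBit (suc n) (suc k) = binomBit n k xor binomBit n (suc k)

parity-C : ∀ n k → parity (n C k) ≡ binomBit n k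
parity-C n zero = refl
parity-C zero (suc k) = cong parity (k>n⇒nCk≡0 {0} {suc k} (s≤s z≤n))
parity-C (suc n) (suc k) = begin
  parity (suc n C suc k)                   ≡⟨ cong parity (nCk+nC[k+1]≡[n+1]C[k+1] n k) ⟨
  parity (n C k + n C suc k)               ≡⟨ parity-+ (n C k) (n C suc k) ⟩
  parity (n C k) xor parity (n C suc k)    ≡⟨ cong₂ _xor_ (parity-C n k) (parity-C n (suc k)) ⟩
  binomBit n k xor binomBit n (suc k)      ∎
  where open ≡-Reasoning

binomBit-< : ∀ {n k} → n < k → binomBit n k ≡ false
binomBit-< {zero} {suc k} _ = refl
binomBit-< {suc n} {suc k} (s≤s n<k) = cong₂ _xor_ (binomBit-< n<k) (binomBit-< (ℕP.m<n⇒m<1+n n<k))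

binomBit-diag : ∀ n → binomBit n n ≡ true
binomBit-diag zero = refl
binomBit-diag (suc n) = cong₂ _xor_ (binomBit-diag n) (binomBit-< (ℕP.n<1+n n))

binom₂ : ℤ → ℤ → Bool
binom₂ a b = mod2 (binomℤ a b)

binom₂-pos : ∀ n k → binom₂ (+ n) (+ k) ≡ binomBit n k
binom₂-pos n k = trans (mod2≡parity (+ (n C k))) (parity-C n k)

-- The sign (-1)^k in C(-(m+1), k) = (-1)^k C(m+k, k) is invisible modulo 2.
binom₂-neg : ∀ m k → binom₂ -[1+ m ] (+ k) ≡ binomBit (m + k) k
binom₂-neg m k = begin
  binom₂ -[1+ m ] (+ k)                   ≡⟨ mod2≡parity (sign ℤ.* + ((m + k) C k)) ⟩
  parity ∣ sign ℤ.* + ((m + k) C k) ∣     ≡⟨ cong parity (ℤP.abs-* sign (+ ((m + k) C k))) ⟩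
  parity (∣ sign ∣ ℕ.* ((m + k) C k))     ≡⟨ cong (λ s → parity (s ℕ.* ((m + k) C k))) (∣-1^k∣ k) ⟩
  parity (1 ℕ.* ((m + k) C k))            ≡⟨ cong parity (ℕP.*-identityˡ ((m + k) C k)) ⟩
  parity ((m + k) C k)                    ≡⟨ parity-C (m + k) k ⟩
  binomBit (m + k) k                      ∎
  where
  open ≡-Reasoning
  sign : ℤ
  sign = (ℤ.- (+ 1)) ℤ.^ k
  ∣-1^k∣ : ∀ k → ∣ (ℤ.- (+ 1)) ℤ.^ k ∣ ≡ 1
  ∣-1^k∣ zero = refl
  ∣-1^k∣ (suc k) = trans (ℤP.abs-* (ℤ.- (+ 1)) ((ℤ.- (+ 1)) ℤ.^ k)) (trans (ℕP.+-identityʳ _) (∣-1^k∣ k))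

binom₂-zero : ∀ a → binom₂ a (+ 0) ≡ true
binom₂-zero (+ n) = binom₂-pos n 0
binom₂-zero -[1+ m ] = binom₂-neg m 0

+1≡suc : ∀ k → + k ℤ.+ + 1 ≡ + suc k
+1≡suc k = cong +_ (ℕP.+-comm k 1)

-- Pascal's rule holds modulo 2 for all integers a, b (it is the defining recursion).
binom₂-pascal : ∀ a b → binom₂ (a ℤ.+ + 1) (b ℤ.+ + 1) ≡ binom₂ a b xor binom₂ a (b ℤ.+ + 1)
binom₂-pascal a -[1+ zero ] = trans (binom₂-zero (a ℤ.+ + 1)) (sym (binom₂-zero a))
binom₂-pascal a -[1+ suc j ] = refl
binom₂-pascal (+ n) (+ k) = begin
  binom₂ (+ n ℤ.+ + 1) (+ k ℤ.+ + 1)             ≡⟨ cong₂ binom₂ (+1≡suc n) (+1≡suc k) ⟩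
  binom₂ (+ suc n) (+ suc k)                     ≡⟨ binom₂-pos (suc n) (suc k) ⟩
  binomBit (suc n) (suc k)
    ≡⟨ cong₂ _xor_ (binom₂-pos n k) (trans (cong (binom₂ (+ n)) (+1≡suc k)) (binom₂-pos n (suc k))) ⟨
  binom₂ (+ n) (+ k) xor binom₂ (+ n) (+ k ℤ.+ + 1) ∎
  where open ≡-Reasoning
binom₂-pascal -[1+ zero ] (+ k) = begin
  binom₂ (+ 0) (+ k ℤ.+ + 1)                     ≡⟨ cong (binom₂ (+ 0)) (+1≡suc k) ⟩
  false                                          ≡⟨⟩
  true xor true                                  ≡⟨ cong₂ _xor_ (trans (binom₂-neg 0 k) (binomBit-diag k))
                                                     (trans (cong (binom₂ -[1+ 0 ]) (+1≡suc k)) (trans (binom₂-neg 0 (suc k)) (binomBit-diag (suc k)))) ⟨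
  binom₂ -[1+ 0 ] (+ k) xor binom₂ -[1+ 0 ] (+ k ℤ.+ + 1) ∎
  where open ≡-Reasoning
binom₂-pascal -[1+ suc m ] (+ k) = begin
  binom₂ -[1+ m ] (+ k ℤ.+ + 1)                  ≡⟨ trans (cong (binom₂ -[1+ m ]) (+1≡suc k)) (binom₂-neg m (suc k)) ⟩
  binomBit p (suc k)                             ≡⟨ 𝔽₂.solve 2 (λ a b → b := a 𝔽₂.:+ (a 𝔽₂.:+ b)) refl (binomBit p k) _ ⟩
  binomBit p k xor binomBit (suc p) (suc k)      ≡⟨ cong (λ t → binomBit t k xor binomBit (suc p) (suc k)) (ℕP.+-suc m k) ⟩
  binomBit (suc m + k) k xor binomBit (suc p) (suc k)
    ≡⟨ cong₂ _xor_ (binom₂-neg (suc m) k) (trans (cong (binom₂ -[1+ suc m ]) (+1≡suc k)) (binom₂-neg (suc m) (suc k))) ⟨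
  binom₂ -[1+ suc m ] (+ k) xor binom₂ -[1+ suc m ] (+ k ℤ.+ + 1) ∎
  where
  open ≡-Reasoning
  open 𝔽₂ using (_:=_)
  -- the upper index of C(-(m+1), k+1) and of C(-(m+2), k)
  p : ℕ
  p = m + suc k

-- Upper negation modulo 2:  C(a, b) ≡ C(b - a - 1, b).  For a ≥ 0 this is the reflection
-- C(n, k) = (-1)^k C(k - n - 1, k); for a < 0 it is the same identity read backwards.
binom₂-upperNeg : ∀ a b → binom₂ a b ≡ binom₂ (b ℤ.- a ℤ.- + 1) b
binom₂-upperNeg a -[1+ j ] = refl
binom₂-upperNeg (+ n) (+ k) with k ℕ.≤? n
... | yes k≤n = begin
  binom₂ (+ n) (+ k)                       ≡⟨ binom₂-pos n k ⟩
  binomBit n k                             ≡⟨ cong (λ t → binomBit t k) n≡d+k ⟩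
  binomBit (d + k) k                       ≡⟨ binom₂-neg d k ⟨
  binom₂ -[1+ d ] (+ k)                    ≡⟨ cong (λ t → binom₂ t (+ k)) reflected ⟨
  binom₂ (+ k ℤ.- + n ℤ.- + 1) (+ k)       ∎
  where
  open ≡-Reasoning
  d : ℕ
  d = proj₁ (ℕP.m≤n⇒∃[o]m+o≡n k≤n)
  n≡d+k : n ≡ d + k
  n≡d+k = trans (sym (proj₂ (ℕP.m≤n⇒∃[o]m+o≡n k≤n))) (ℕP.+-comm k d)
  reflected : + k ℤ.- + n ℤ.- + 1 ≡ -[1+ d ]
  reflected = begin
    + k ℤ.- + n ℤ.- + 1           ≡⟨ cong (λ t → + k ℤ.- t ℤ.- + 1) (trans (cong +_ n≡d+k) (ℤP.pos-+ d k)) ⟩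
    + k ℤ.- (+ d ℤ.+ + k) ℤ.- + 1 ≡⟨ identity (+ d) (+ k) ⟩
    ℤ.- (+ 1 ℤ.+ + d)             ∎
    where
    identity : ∀ d k → k ℤ.- (d ℤ.+ k) ℤ.- + 1 ≡ ℤ.- (+ 1 ℤ.+ d)
    identity = ℤSolver.solve-∀
... | no k≰n = begin
  binom₂ (+ n) (+ k)                       ≡⟨ trans (binom₂-pos n k) (binomBit-< n<k) ⟩
  false                                    ≡⟨ trans (binom₂-pos d k) (binomBit-< d<k) ⟨
  binom₂ (+ d) (+ k)                       ≡⟨ cong (λ t → binom₂ t (+ k)) reflected ⟨
  binom₂ (+ k ℤ.- + n ℤ.- + 1) (+ k)       ∎
  where
  open ≡-Reasoning
  n<k : n < k
  n<k = ℕP.≰⇒> k≰n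
  d : ℕ
  d = proj₁ (ℕP.m≤n⇒∃[o]m+o≡n n<k)
  k≡1+n+d : k ≡ suc (n + d)
  k≡1+n+d = sym (proj₂ (ℕP.m≤n⇒∃[o]m+o≡n n<k))
  d<k : d < k
  d<k = subst (d <_) (sym k≡1+n+d) (s≤s (ℕP.m≤n+m d n))
  reflected : + k ℤ.- + n ℤ.- + 1 ≡ + d
  reflected = begin
    + k ℤ.- + n ℤ.- + 1
      ≡⟨ cong (λ t → t ℤ.- + n ℤ.- + 1) (trans (cong +_ k≡1+n+d) (cong (ℤ._+_ (+ 1)) (ℤP.pos-+ n d))) ⟩
    + 1 ℤ.+ (+ n ℤ.+ + d) ℤ.- + n ℤ.- + 1   ≡⟨ identity (+ n) (+ d) ⟩
    + d                                     ∎
    where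
    identity : ∀ n d → + 1 ℤ.+ (n ℤ.+ d) ℤ.- n ℤ.- + 1 ≡ d
    identity = ℤSolver.solve-∀
binom₂-upperNeg -[1+ m ] (+ k) = begin
  binom₂ -[1+ m ] (+ k)                    ≡⟨ binom₂-neg m k ⟩
  binomBit (m + k) k                       ≡⟨ cong (λ t → binomBit t k) (ℕP.+-comm m k) ⟩
  binomBit (k + m) k                       ≡⟨ binom₂-pos (k + m) k ⟨
  binom₂ (+ (k + m)) (+ k)                 ≡⟨ cong (λ t → binom₂ t (+ k)) reflected ⟨
  binom₂ (+ k ℤ.- -[1+ m ] ℤ.- + 1) (+ k)  ∎
  where
  open ≡-Reasoning
  reflected : + k ℤ.- -[1+ m ] ℤ.- + 1 ≡ + (k + m)
  reflected = begin
    + k ℤ.- -[1+ m ] ℤ.- + 1            ≡⟨ identity (+ k) (+ m) ⟩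
    + k ℤ.+ + m                         ≡⟨ ℤP.pos-+ k m ⟨
    + (k + m)                           ∎
    where
    identity : ∀ k m → k ℤ.- ℤ.- (+ 1 ℤ.+ m) ℤ.- + 1 ≡ k ℤ.+ m
    identity = ℤSolver.solve-∀

∸-≡ : ∀ {a} b {c} → a ≡ b + c → a ∸ b ≡ c
∸-≡ b {c} refl = ℕP.m+n∸m≡n b c

-- Barycentric coordinates.  The entry (i, j), 1 ≤ j ≤ i ≤ n, of a triangle of size n sits at
-- the lattice point (x, y, z) = (j - 1, i - j, n - i) of the simplex x + y + z = n - 1.  In
-- these coordinates Pascal's rule reads f(x+1, y+1, z) = f(x, y+1, z+1) + f(x+1, y, z+1),
-- the map h′ exchanges x and y, and r′ permutes (x, y, z) cyclically.
coords : Tri → ℕ → ℕ → ℕ → Bool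
coords a x y z = a (suc (x + y)) (suc x)

record Point (n i j : ℕ) : Set where
  constructor point
  field
    x y z : ℕ
    i≡ : i ≡ suc (x + y)
    j≡ : j ≡ suc x
    n≡ : n ≡ suc (x + y + z)

toPoint : ∀ {n i j} → 1 ≤ j → j ≤ i → i ≤ n → Point n i j
toPoint {n} {i} {suc x} _ j≤i i≤n = point x y z (sym i≡) refl (sym (trans (cong (_+ z) i≡) n≡))
  where
  y z : ℕ
  y = proj₁ (ℕP.m≤n⇒∃[o]m+o≡n j≤i)
  i≡ : suc (x + y) ≡ i
  i≡ = proj₂ (ℕP.m≤n⇒∃[o]m+o≡n j≤i)
  z = proj₁ (ℕP.m≤n⇒∃[o]m+o≡n i≤n)
  n≡ : i + z ≡ n
  n≡ = proj₂ (ℕP.m≤n⇒∃[o]m+o≡n i≤n)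

_≗[_]_ : (ℕ → ℕ → ℕ → Bool) → ℕ → (ℕ → ℕ → ℕ → Bool) → Set
f ≗[ n ] g = ∀ x y z → suc (x + y + z) ≡ n → f x y z ≡ g x y z

≈-fromCoords : ∀ {n a b} → coords a ≗[ n ] coords b → a ≈[ n ] b
≈-fromCoords {n} eq i j 1≤j j≤i i≤n with toPoint {n} 1≤j j≤i i≤n
... | point x y z refl refl n≡ = eq x y z (sym n≡)

-- A function on the simplex invariant under all permutations of the coordinates
-- (generated by a transposition and a rotation) and satisfying Pascal's rule.
record IsSymPascal (n : ℕ) (f : ℕ → ℕ → ℕ → Bool) : Set where
  field
    swap   : ∀ x y z → suc (x + y + z) ≡ n → f x y z ≡ f y x z
    rotate : ∀ x y z → suc (x + y + z) ≡ n → f x y z ≡ f z x y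
    pascal : ∀ x y z → suc (suc (suc (x + y + z))) ≡ n →
             f (suc x) (suc y) z ≡ f x (suc y) (suc z) xor f (suc x) y (suc z)

r′-coords : ∀ a x y z → r′ (suc (x + y + z)) a (suc (x + y)) (suc x) ≡ coords a z x y
r′-coords a x y z = cong₂ a (∸-≡ (suc (x + y)) (identity₁ x y z)) (∸-≡ (suc (x + y)) (identity₂ x y z))
  where
  identity₁ : ∀ x y z → suc (x + y + z) + suc x ≡ suc (x + y) + suc (z + x)
  identity₁ = ℕSolver.solve-∀
  identity₂ : ∀ x y z → suc (x + y + z) + 1 ≡ suc (x + y) + suc z
  identity₂ = ℕSolver.solve-∀

h′-coords : ∀ a x y z → h′ a (suc (x + y)) (suc x) ≡ coords a y x z
h′-coords a x y z = begin
  a (suc (x + y)) (1 + suc (x + y) ∸ suc x)   ≡⟨ cong (a (suc (x + y))) (∸-≡ (suc x) (cong suc (sym (ℕP.+-suc x y)))) ⟩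
  a (suc (x + y)) (suc y)                     ≡⟨ cong (λ t → a (suc t) (suc y)) (ℕP.+-comm x y) ⟩
  a (suc (y + x)) (suc y)                     ∎
  where open ≡-Reasoning

reorder : ∀ {n p q} → p ≡ q → suc q ≡ n → suc p ≡ n
reorder p≡q = trans (cong suc p≡q)

+-132 : ∀ x y z → x + z + y ≡ x + y + z
+-132 = ℕSolver.solve-∀
+-213 : ∀ x y z → y + x + z ≡ x + y + z
+-213 = ℕSolver.solve-∀
+-231 : ∀ x y z → y + z + x ≡ x + y + z
+-231 = ℕSolver.solve-∀
+-312 : ∀ x y z → z + x + y ≡ x + y + z
+-312 = ℕSolver.solve-∀
+-321 : ∀ x y z → z + y + x ≡ x + y + z
+-321 = ℕSolver.solve-∀

row≤size : ∀ {n} x y z → suc (x + y + z) ≡ n → suc (x + y) ≤ n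
row≤size x y z refl = s≤s (ℕP.m≤m+n (x + y) z)

DPT⇒symPascal : ∀ {n a} → IsDPT n a → IsSymPascal n (coords a)
DPT⇒symPascal {n} {a} (isPT , r′a≈a , h′a≈a) = record { swap = swap ; rotate = rotate ; pascal = pascal }
  where
  at : ∀ {b c} → b ≈[ n ] c → ∀ x y z → suc (x + y + z) ≡ n → b (suc (x + y)) (suc x) ≡ c (suc (x + y)) (suc x)
  at b≈c x y z n≡ = b≈c (suc (x + y)) (suc x) (s≤s z≤n) (s≤s (ℕP.m≤m+n x y)) (row≤size x y z n≡)

  swap : ∀ x y z → suc (x + y + z) ≡ n → coords a x y z ≡ coords a y x z
  swap x y z n≡ = trans (sym (at h′a≈a x y z n≡)) (h′-coords a x y z)

  rotate : ∀ x y z → suc (x + y + z) ≡ n → coords a x y z ≡ coords a z x y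
  rotate x y z refl = trans (sym (at r′a≈a x y z refl)) (r′-coords a x y z)

  pascal : ∀ x y z → suc (suc (suc (x + y + z))) ≡ n →
           coords a (suc x) (suc y) z ≡ coords a x (suc y) (suc z) xor coords a (suc x) y (suc z)
  pascal x y z n≡ = trans
    (isPT (suc (suc x + suc y)) (suc (suc x)) (s≤s (s≤s z≤n)) (s≤s (s≤s (ℕP.m<m+n x (s≤s z≤n)))) (row≤size (suc x) (suc y) z n≡′))
    (cong (λ t → coords a x (suc y) (suc z) xor a (suc t) (suc (suc x))) (ℕP.+-suc x y))
    where
    n≡′ : suc (suc x + suc y + z) ≡ n
    n≡′ = trans (cong (λ t → suc (suc t + z)) (ℕP.+-suc x y)) n≡

symPascal⇒DPT : ∀ {n a f} → coords a ≗[ n ] f → IsSymPascal n f → IsDPT n a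
symPascal⇒DPT {n} {a} {f} a≗f sp = isPT , ≈-fromCoords rotated , ≈-fromCoords swapped
  where
  open IsSymPascal sp

  isPT : IsPT n a
  isPT i j 2≤j j<i i≤n with toPoint {n} (ℕP.≤-trans (s≤s z≤n) 2≤j) (ℕP.<⇒≤ j<i) i≤n
  ... | point (suc x) (suc y) z refl refl n≡ = begin
    coords a (suc x) (suc y) z                                   ≡⟨ a≗f (suc x) (suc y) z (sym n≡) ⟩
    f (suc x) (suc y) z
      ≡⟨ pascal x y z (sym (trans n≡ (cong (λ t → suc (suc t + z)) (ℕP.+-suc x y)))) ⟩
    f x (suc y) (suc z) xor f (suc x) y (suc z)                  ≡⟨ cong₂ _xor_ (a≗f x (suc y) (suc z) (sym (trans n≡ (identity₁ x y z))))
                                                                      (a≗f (suc x) y (suc z) (sym (trans n≡ (identity₂ x y z)))) ⟨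
    coords a x (suc y) (suc z) xor coords a (suc x) y (suc z)
      ≡⟨ cong (λ t → coords a x (suc y) (suc z) xor a (suc t) (suc (suc x))) (ℕP.+-suc x y) ⟨
    a (suc x + suc y) (suc x) xor a (suc x + suc y) (suc (suc x)) ∎
    where
    open ≡-Reasoning
    identity₁ : ∀ x y z → suc (suc x + suc y + z) ≡ suc (x + suc y + suc z)
    identity₁ = ℕSolver.solve-∀
    identity₂ : ∀ x y z → suc (suc x + suc y + z) ≡ suc (suc x + y + suc z)
    identity₂ = ℕSolver.solve-∀
  ... | point zero y z refl refl n≡ with s≤s () ← 2≤j
  ... | point (suc x) zero z refl refl n≡ = ⊥-elim (ℕP.<-irrefl (cong (λ t → suc (suc t)) (sym (ℕP.+-identityʳ x))) j<i)

  rotated : coords (r′ n a) ≗[ n ] coords a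
  rotated x y z refl = begin
    r′ n a (suc (x + y)) (suc x)  ≡⟨ r′-coords a x y z ⟩
    coords a z x y                ≡⟨ a≗f z x y (reorder (+-312 x y z) refl) ⟩
    f z x y                       ≡⟨ rotate x y z refl ⟨
    f x y z                       ≡⟨ a≗f x y z refl ⟨
    coords a x y z                ∎
    where open ≡-Reasoning

  swapped : coords (h′ a) ≗[ n ] coords a
  swapped x y z n≡ = begin
    h′ a (suc (x + y)) (suc x)  ≡⟨ h′-coords a x y z ⟩
    coords a y x z              ≡⟨ a≗f y x z (reorder (+-213 x y z) n≡) ⟩
    f y x z                     ≡⟨ swap x y z n≡ ⟨
    f x y z                     ≡⟨ a≗f x y z n≡ ⟨
    coords a x y z              ∎
    where open ≡-Reasoning

DPT-⊕ : ∀ {n a b} → IsDPT n a → IsDPT n b → IsDPT n (a ⊕ b)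
DPT-⊕ {a = a} {b} (PTa , r′a , h′a) (PTb , r′b , h′b) =
  (λ i j 2≤j j<i i≤n → trans (cong₂ _xor_ (PTa i j 2≤j j<i i≤n) (PTb i j 2≤j j<i i≤n))
                             (interchange (a (i ∸ 1) (j ∸ 1)) (a (i ∸ 1) j) (b (i ∸ 1) (j ∸ 1)) (b (i ∸ 1) j))) ,
  (λ i j 1≤j j≤i i≤n → cong₂ _xor_ (r′a i j 1≤j j≤i i≤n) (r′b i j 1≤j j≤i i≤n)) ,
  (λ i j 1≤j j≤i i≤n → cong₂ _xor_ (h′a i j 1≤j j≤i i≤n) (h′b i j 1≤j j≤i i≤n))
  where
  interchange : ∀ p q r s → (p xor q) xor (r xor s) ≡ (p xor r) xor (q xor s)
  interchange = 𝔽₂.solve 4 (λ p q r s → (p :+ q) :+ (r :+ s) := (p :+ r) :+ (q :+ s)) refl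
    where open 𝔽₂ using (_:+_; _:=_)

-- Rigidity.  Pascal's rule propagates
-- the zeros to all points with two coordinates below m; the remaining points are reached by
-- downward induction on the smallest coordinate, using symmetry to sort the coordinates.
module Rigidity {n m : ℕ} {f : ℕ → ℕ → ℕ → Bool} (sp : IsSymPascal n f) (n≤3m : n ≤ 3 * m)
                (edge : ∀ y z → suc (y + z) ≡ n → y < m → f 0 y z ≡ false) where
  open IsSymPascal sp

  swap₂₃ : ∀ x y z → suc (x + y + z) ≡ n → f x y z ≡ f x z y
  swap₂₃ x y z n≡ = trans (swap x y z n≡) (sym (rotate x z y (reorder (+-132 x y z) n≡)))

  rotate⁻¹ : ∀ x y z → suc (x + y + z) ≡ n → f x y z ≡ f y z x
  rotate⁻¹ x y z n≡ = sym (rotate y z x (reorder (+-231 x y z) n≡))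

  swap₁₃ : ∀ x y z → suc (x + y + z) ≡ n → f x y z ≡ f z y x
  swap₁₃ x y z n≡ = trans (rotate x y z n≡) (swap₂₃ z x y (reorder (+-312 x y z) n≡))

  headSmall : ∀ x y z → suc (x + y + z) ≡ n → x < m → y < m → f x y z ≡ false
  headSmall zero y z n≡ _ y<m = edge y z n≡ y<m
  headSmall (suc x) zero z n≡ x<m _ =
    trans (swap (suc x) 0 z n≡) (edge (suc x) z (trans (cong (λ t → suc (t + z)) (sym (ℕP.+-identityʳ (suc x)))) n≡) x<m)
  headSmall (suc x) (suc y) z n≡ x<m y<m = begin
    f (suc x) (suc y) z                          ≡⟨ pascal x y z (trans (identity₀ x y z) n≡) ⟩
    f x (suc y) (suc z) xor f (suc x) y (suc z)  ≡⟨ cong₂ _xor_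
                                                      (headSmall x (suc y) (suc z) (trans (identity₁ x y z) n≡) (ℕP.<⇒≤ x<m) y<m)
                                                      (headSmall (suc x) y (suc z) (trans (identity₂ x y z) n≡) x<m (ℕP.<⇒≤ y<m)) ⟩
    false                                        ∎
    where
    open ≡-Reasoning
    identity₀ : ∀ x y z → suc (suc (suc (x + y + z))) ≡ suc (suc x + suc y + z)
    identity₀ = ℕSolver.solve-∀
    identity₁ : ∀ x y z → suc (x + suc y + suc z) ≡ suc (suc x + suc y + z)
    identity₁ = ℕSolver.solve-∀
    identity₂ : ∀ x y z → suc (suc x + y + suc z) ≡ suc (suc x + suc y + z)
    identity₂ = ℕSolver.solve-∀

  tailSmall : ∀ x y z → suc (x + y + z) ≡ n → y < m → z < m → f x y z ≡ false
  tailSmall x y z n≡ y<m z<m =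
    trans (rotate⁻¹ x y z n≡) (headSmall y z x (reorder (+-231 x y z) n≡) y<m z<m)

  -- f vanishes on the median lines: Pascal's rule at (x, y, y) and the symmetry y ↔ z give
  -- f(x+1, y+1, y) = f(x, y+1, y+1) + f(x+1, y+1, y).
  diagonal : ∀ x y → suc (x + suc y + suc y) ≡ n → f x (suc y) (suc y) ≡ false
  diagonal x y n≡ = cancel (trans (sym (swap₂₃ (suc x) (suc y) y (trans (identity₂ x y) n≡))) (pascal x y y (trans (identity₁ x y) n≡)))
    where
    cancel : ∀ {b c : Bool} → c ≡ b xor c → b ≡ false
    cancel {false} _ = refl
    cancel {true} {false} ()
    cancel {true} {true} ()
    identity₁ : ∀ x y → suc (suc (suc (x + y + y))) ≡ suc (x + suc y + suc y)
    identity₁ = ℕSolver.solve-∀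
    identity₂ : ∀ x y → suc (suc x + suc y + y) ≡ suc (x + suc y + suc y)
    identity₂ = ℕSolver.solve-∀

  m-positive : ∀ {k} → suc k ≡ n → 0 < m
  m-positive n≡ = ℕP.≰⇒> λ m≤0 → ℕP.<⇒≱ (s≤s z≤n) (subst₂ _≤_ (sym n≡) (cong (3 *_) (ℕP.n≤0⇒n≡0 m≤0)) n≤3m)

  VanishesFrom : ℕ → Set
  VanishesFrom c = ∀ x y z → suc (x + y + z) ≡ n → c ≤ x → c ≤ y → c ≤ z → f x y z ≡ false

  -- Sorted points a ≥ b ≥ d with b ≥ m: the three shapes b = d, b = d + 1 and b ≥ d + 2.
  onDiagonal : ∀ a d → suc (a + d + d) ≡ n → m ≤ d → f a d d ≡ false
  onDiagonal a zero n≡ m≤0 = ⊥-elim (ℕP.<⇒≱ (m-positive n≡) m≤0)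
  onDiagonal a (suc d) n≡ _ = diagonal a d n≡

  -- A sorted point with b = d + 1 ≥ m has a = b, because a + 2b ≤ n ≤ 3m ≤ 3b.
  balanced : ∀ a d → suc (a + suc d + d) ≡ n → m ≤ suc d → a ≤ suc d
  balanced a d n≡ m≤b = ℕP.+-cancelʳ-≤ (b + b) a b (begin
    a + (b + b)       ≡⟨ identity₁ a d ⟩
    suc (a + b + d)   ≡⟨ n≡ ⟩
    n                 ≤⟨ n≤3m ⟩
    3 * m             ≤⟨ ℕP.*-monoʳ-≤ 3 m≤b ⟩
    3 * b             ≡⟨ identity₂ b ⟩
    b + (b + b)       ∎)
    where
    open ℕP.≤-Reasoning
    b : ℕ
    b = suc d
    identity₁ : ∀ a d → a + (suc d + suc d) ≡ suc (a + suc d + d)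
    identity₁ = ℕSolver.solve-∀
    identity₂ : ∀ b → 3 * b ≡ b + (b + b)
    identity₂ = ℕSolver.solve-∀

  -- So f(a, d + 1, d) = f(d, d + 1, d + 1) by symmetry, which vanishes.
  nearDiagonal : ∀ a d → suc (a + suc d + d) ≡ n → m ≤ suc d → suc d ≤ a → f a (suc d) d ≡ false
  nearDiagonal a d n≡ m≤b b≤a = begin
    f a (suc d) d          ≡⟨ rotate a (suc d) d n≡ ⟩
    f d a (suc d)          ≡⟨ cong (λ t → f d t (suc d)) a≡b ⟩
    f d (suc d) (suc d)    ≡⟨ diagonal d d (trans (cong (λ t → suc (d + suc d + t)) (sym a≡b)) (trans (cong suc (identity a d)) n≡)) ⟩
    false                  ∎
    where
    open ≡-Reasoning
    a≡b : a ≡ suc d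
    a≡b = ℕP.≤-antisym (balanced a d n≡ m≤b) b≤a
    identity : ∀ a d → d + suc d + a ≡ a + suc d + d
    identity = ℕSolver.solve-∀

  -- For b ≥ d + 2, Pascal's rule writes f(a, b, d) through two sorted points whose
  -- coordinates are all at least c + 1.
  spread : ∀ c → VanishesFrom (suc c) → ∀ a b d → suc (suc a + suc b + d) ≡ n →
           b ≤ a → suc d ≤ b → c ≤ d → f (suc a) (suc b) d ≡ false
  spread c above a b d n≡ b≤a d<b c≤d = begin
    f (suc a) (suc b) d                          ≡⟨ pascal a b d (trans (identity₀ a b d) n≡) ⟩
    f a (suc b) (suc d) xor f (suc a) b (suc d)  ≡⟨ cong₂ _xor_
      (above a (suc b) (suc d) (trans (identity₁ a b d) n≡) c<a (ℕP.m≤n⇒m≤1+n c<b) (s≤s c≤d))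
      (above (suc a) b (suc d) (trans (identity₂ a b d) n≡) (ℕP.m≤n⇒m≤1+n c<a) c<b (s≤s c≤d)) ⟩
    false                                        ∎
    where
    open ≡-Reasoning
    c<b : suc c ≤ b
    c<b = ℕP.≤-trans (s≤s c≤d) d<b
    c<a : suc c ≤ a
    c<a = ℕP.≤-trans c<b b≤a
    identity₀ : ∀ a b d → suc (suc (suc (a + b + d))) ≡ suc (suc a + suc b + d)
    identity₀ = ℕSolver.solve-∀
    identity₁ : ∀ a b d → suc (a + suc b + suc d) ≡ suc (suc a + suc b + d)
    identity₁ = ℕSolver.solve-∀
    identity₂ : ∀ a b d → suc (suc a + b + suc d) ≡ suc (suc a + suc b + d)
    identity₂ = ℕSolver.solve-∀

  sortedStep : ∀ c → VanishesFrom (suc c) → ∀ a b d → suc (a + b + d) ≡ n → b ≤ a → d ≤ b → c ≤ d → f a b d ≡ false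
  sortedStep c above a b d n≡ b≤a d≤b c≤d with b ℕ.<? m
  ... | yes b<m = tailSmall a b d n≡ b<m (ℕP.≤-<-trans d≤b b<m)
  ... | no b≮m with ℕP.m≤n⇒m<n∨m≡n d≤b
  ...   | inj₂ refl = onDiagonal a d n≡ (ℕP.≮⇒≥ b≮m)
  ...   | inj₁ d<b with ℕP.m≤n⇒m<n∨m≡n d<b
  ...     | inj₂ refl = nearDiagonal a d n≡ (ℕP.≮⇒≥ b≮m) b≤a
  sortedStep c above (suc a) (suc b) d n≡ (s≤s b≤a) _ c≤d | no _ | inj₁ _ | inj₁ (s≤s d<b) =
    spread c above a b d n≡ b≤a d<b c≤d

  step : ∀ c → VanishesFrom (suc c) → VanishesFrom c
  step c above x y z n≡ c≤x c≤y c≤z with ℕP.≤-total y x | ℕP.≤-total z y | ℕP.≤-total z x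
  ... | inj₁ y≤x | inj₁ z≤y | _ = sortedStep c above x y z n≡ y≤x z≤y c≤z
  ... | inj₁ y≤x | inj₂ y≤z | inj₁ z≤x =
    trans (swap₂₃ x y z n≡) (sortedStep c above x z y (reorder (+-132 x y z) n≡) z≤x y≤z c≤y)
  ... | inj₁ y≤x | inj₂ y≤z | inj₂ x≤z =
    trans (rotate x y z n≡) (sortedStep c above z x y (reorder (+-312 x y z) n≡) x≤z y≤x c≤y)
  ... | inj₂ x≤y | _ | inj₁ z≤x =
    trans (swap x y z n≡) (sortedStep c above y x z (reorder (+-213 x y z) n≡) x≤y z≤x c≤z)
  ... | inj₂ x≤y | inj₁ z≤y | inj₂ x≤z =
    trans (rotate⁻¹ x y z n≡) (sortedStep c above y z x (reorder (+-231 x y z) n≡) z≤y x≤z c≤x)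
  ... | inj₂ x≤y | inj₂ y≤z | inj₂ _ =
    trans (swap₁₃ x y z n≡) (sortedStep c above z y x (reorder (+-321 x y z) n≡) y≤z x≤y c≤x)

  vanishesFrom : ∀ k c → n ≤ c + k → VanishesFrom c
  vanishesFrom zero c n≤c x y z n≡ c≤x _ _ =
    ⊥-elim (ℕP.<⇒≱ (subst (x <_) n≡ (s≤s (ℕP.≤-trans (ℕP.m≤m+n x y) (ℕP.m≤m+n (x + y) z))))
                   (ℕP.≤-trans (subst (n ≤_) (ℕP.+-identityʳ c) n≤c) c≤x))
  vanishesFrom (suc k) c n≤c+k = step c (vanishesFrom k (suc c) (subst (n ≤_) (ℕP.+-suc c k) n≤c+k))

  vanishes : ∀ x y z → suc (x + y + z) ≡ n → f x y z ≡ false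
  vanishes x y z n≡ = vanishesFrom n 0 ℕP.≤-refl x y z n≡ z≤n z≤n z≤n

LeadingZeros : ℕ → Tri → Set
LeadingZeros q a = ∀ p → 1 ≤ p → p ≤ q → a p 1 ≡ false

DPT-rigid : ∀ {n m a} → IsDPT n a → n ≤ 3 * m → LeadingZeros m a → a ≈[ n ] zeroTri
DPT-rigid {n} {m} {a} dpt n≤3m left = ≈-fromCoords (Rigidity.vanishes (DPT⇒symPascal dpt) n≤3m edge)
  where
  edge : ∀ y z → suc (y + z) ≡ n → y < m → a (suc y) 1 ≡ false
  edge y z _ y<m = left (suc y) (s≤s z≤n) y<m

lincomb-zero : ∀ {m} (c : Fin m → Bool) (v : Fin m → Tri) i j → (∀ t → (c t ∧ v t i j) ≡ false) → lincomb c v i j ≡ false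
lincomb-zero {zero} c v i j _ = refl
lincomb-zero {suc m} c v i j terms = cong₂ _xor_ (terms Fin.zero) (lincomb-zero (c ∘ Fin.suc) (v ∘ Fin.suc) i j (terms ∘ Fin.suc))

lincomb-single : ∀ {m} (c : Fin m → Bool) (v : Fin m → Tri) i j t₀ →
                 (∀ t → t ≢ t₀ → (c t ∧ v t i j) ≡ false) → lincomb c v i j ≡ (c t₀ ∧ v t₀ i j)
lincomb-single c v i j Fin.zero others =
  trans (cong ((c Fin.zero ∧ v Fin.zero i j) xor_) (lincomb-zero (c ∘ Fin.suc) (v ∘ Fin.suc) i j (λ t → others (Fin.suc t) λ ())))
        (xor-comm _ false)
lincomb-single c v i j (Fin.suc t₀) others =
  cong₂ _xor_ (others Fin.zero λ ())
    (lincomb-single (c ∘ Fin.suc) (v ∘ Fin.suc) i j t₀ (λ t t≢t₀ → others (Fin.suc t) (t≢t₀ ∘ FinP.suc-injective)))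

flipAt : ∀ {m} → (Fin m → Bool) → Fin m → Fin m → Bool
flipAt c t₀ t = does (t FinP.≟ t₀) xor c t

lincomb-flip : ∀ {m} (c : Fin m → Bool) (v : Fin m → Tri) i j t₀ →
               lincomb (flipAt c t₀) v i j ≡ lincomb c v i j xor v t₀ i j
lincomb-flip c v i j Fin.zero =
  𝔽₂.solve 3 (λ c₀ v₀ s → ((con true :+ c₀) :* v₀) :+ s := ((c₀ :* v₀) :+ s) :+ v₀) refl
    (c Fin.zero) (v Fin.zero i j) (lincomb (c ∘ Fin.suc) (v ∘ Fin.suc) i j)
  where open 𝔽₂
lincomb-flip c v i j (Fin.suc t₀) = begin
  (c Fin.zero ∧ v Fin.zero i j) xor lincomb (flipAt (c ∘ Fin.suc) t₀) (v ∘ Fin.suc) i j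
    ≡⟨ cong ((c Fin.zero ∧ v Fin.zero i j) xor_) (lincomb-flip (c ∘ Fin.suc) (v ∘ Fin.suc) i j t₀) ⟩
  (c Fin.zero ∧ v Fin.zero i j) xor (lincomb (c ∘ Fin.suc) (v ∘ Fin.suc) i j xor v (Fin.suc t₀) i j)
    ≡⟨ xor-assoc (c Fin.zero ∧ v Fin.zero i j) _ _ ⟨
  lincomb c v i j xor v (Fin.suc t₀) i j ∎
  where open ≡-Reasoning

-- Echelon form.
module Echelon {n m : ℕ} {P : Tri → Set} (v : Fin m → Tri)
  (closed : ∀ {a b} → P a → P b → P (a ⊕ b))
  (member : ∀ t → P (v t))
  (leading : ∀ t → LeadingZeros (toℕ t) (v t))
  (pivot : ∀ t → v t (suc (toℕ t)) 1 ≡ true)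
  (m≤n : m ≤ n)
  (rigid : ∀ {a} → P a → LeadingZeros m a → a ≈[ n ] zeroTri) where

  -- Evaluating a vanishing combination at the pivot of v_t, where all earlier coefficients
  -- are already known to vanish, isolates the coefficient of v_t.
  independent : LinIndep n v
  independent c comb≈0 t = before m t (FinP.toℕ<n t)
    where
    before : ∀ q t → toℕ t < q → c t ≡ false
    before (suc q) t t<q+1 with toℕ t ℕ.<? q
    ... | yes t<q = before q t t<q
    ... | no t≮q = begin
      c t                              ≡⟨ ∧-identityʳ (c t) ⟨
      c t ∧ true                       ≡⟨ cong (c t ∧_) (subst (λ r → v t (suc r) 1 ≡ true) t≡q (pivot t)) ⟨
      c t ∧ v t (suc q) 1              ≡⟨ lincomb-single c v (suc q) 1 t others ⟨
      lincomb c v (suc q) 1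
        ≡⟨ comb≈0 (suc q) 1 (s≤s z≤n) (s≤s z≤n) (ℕP.≤-trans (subst (λ r → suc r ≤ m) t≡q (FinP.toℕ<n t)) m≤n) ⟩
      false                            ∎
      where
      open ≡-Reasoning
      t≡q : toℕ t ≡ q
      t≡q = ℕP.≤-antisym (ℕP.<⇒≤pred t<q+1) (ℕP.≮⇒≥ t≮q)
      others : ∀ s → s ≢ t → (c s ∧ v s (suc q) 1) ≡ false
      others s s≢t with ℕ.<-cmp (toℕ s) q
      ... | tri< s<q _ _ = cong (_∧ v s (suc q) 1) (before q s s<q)
      ... | tri≈ _ s≡q _ = ⊥-elim (s≢t (FinP.toℕ-injective (trans s≡q (sym t≡q))))
      ... | tri> _ _ q<s = trans (cong (c s ∧_) (leading s (suc q) (s≤s z≤n) q<s)) (∧-zeroʳ (c s))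

  -- Greedy elimination, by downward induction on the number q of leading zeros: if the
  -- entry in row q + 1 is 1, adding v_q clears it.
  eliminate : ∀ d q → q + d ≡ m → ∀ a → P a → LeadingZeros q a → Σ (Fin m → Bool) (λ c → a ≈[ n ] lincomb c v)
  eliminate zero q q≡m a Pa zeros = (λ _ → false) , λ i j 1≤j j≤i i≤n →
    trans (rigid Pa (subst (λ r → LeadingZeros r a) (trans (sym (ℕP.+-identityʳ q)) q≡m) zeros) i j 1≤j j≤i i≤n)
          (sym (lincomb-zero (λ _ → false) v i j (λ _ → refl)))
  eliminate (suc d) q q+d≡m a Pa zeros with a (suc q) 1 in row
  ... | false = eliminate d (suc q) (trans (sym (ℕP.+-suc q d)) q+d≡m) a Pa extended
    where
    extended : LeadingZeros (suc q) a
    extended p 1≤p p≤q+1 with ℕP.m≤n⇒m<n∨m≡n p≤q+1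
    ... | inj₁ p≤q = zeros p 1≤p (ℕP.<⇒≤pred p≤q)
    ... | inj₂ refl = row
  ... | true = flipAt c t , λ i j 1≤j j≤i i≤n → sym (begin
      lincomb (flipAt c t) v i j        ≡⟨ lincomb-flip c v i j t ⟩
      lincomb c v i j xor v t i j       ≡⟨ cong (_xor v t i j) (rest i j 1≤j j≤i i≤n) ⟨
      (a i j xor v t i j) xor v t i j
        ≡⟨ trans (xor-assoc (a i j) _ _) (trans (cong (a i j xor_) (xor-same (v t i j))) (xor-comm (a i j) false)) ⟩
      a i j                             ∎)
    where
    open ≡-Reasoning
    q<m : q < m
    q<m = subst (q <_) q+d≡m (ℕP.m<m+n q (s≤s z≤n))
    t : Fin m
    t = Fin.fromℕ< q<m
    t≡q : toℕ t ≡ q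
    t≡q = FinP.toℕ-fromℕ< q<m
    cleared : LeadingZeros (suc q) (a ⊕ v t)
    cleared p 1≤p p≤q+1 with ℕP.m≤n⇒m<n∨m≡n p≤q+1
    ... | inj₁ p≤q = cong₂ _xor_ (zeros p 1≤p (ℕP.<⇒≤pred p≤q)) (leading t p 1≤p (subst (p ≤_) (sym t≡q) (ℕP.<⇒≤pred p≤q)))
    ... | inj₂ refl = cong₂ _xor_ row (subst (λ r → v t (suc r) 1 ≡ true) t≡q (pivot t))
    reduced : Σ (Fin m → Bool) (λ c → (a ⊕ v t) ≈[ n ] lincomb c v)
    reduced = eliminate d (suc q) (trans (sym (ℕP.+-suc q d)) q+d≡m) (a ⊕ v t) (closed Pa (member t)) cleared
    c : Fin m → Bool
    c = proj₁ reduced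
    rest : (a ⊕ v t) ≈[ n ] lincomb c v
    rest = proj₂ reduced

  spanning : Spans n P v
  spanning a Pa = eliminate m 0 refl a Pa (λ { (suc p) _ () })

  basis : IsBasis n P v
  basis = member , independent , spanning

ρ-unfold : ∀ N a i j {i₁ j₁ i₂ j₂} → j ∸ i + 1 ≡ i₁ → N ∸ i + 1 ≡ j₁ → j₁ ∸ i₁ + 1 ≡ i₂ → N ∸ i₁ + 1 ≡ j₂ →
           ρ N a i j ≡ (a i₂ j₂ xor a i₁ j₁) xor a i j
ρ-unfold N a i j refl refl refl refl = refl

γρ-coords : ∀ a x y z → let w = x + y + z in
  coords (γ (suc w) (ρ (2 * suc w ∸ 1) a)) x y z ≡
  (a (suc (z + y)) (suc (w + y)) xor a (suc (x + z)) (suc (w + z))) xor a (suc (y + x)) (suc (w + x))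
γρ-coords a x y z = begin
  ρ N a (suc (x + y)) (w + suc x)
    ≡⟨ ρ-unfold N a (suc (x + y)) (w + suc x) (index (identity₁ x y z)) (index (identity₂ x y z))
                                              (index {b = x + z} (identity₃ x y z)) (index (identity₄ x y z)) ⟩
  (a (suc (z + y)) (suc (w + y)) xor a (suc (x + z)) (suc (w + z))) xor a (suc (x + y)) (w + suc x)
    ≡⟨ cong₂ (λ i j → (a (suc (z + y)) (suc (w + y)) xor a (suc (x + z)) (suc (w + z))) xor a (suc i) j) (ℕP.+-comm x y) (ℕP.+-suc w x) ⟩
  (a (suc (z + y)) (suc (w + y)) xor a (suc (x + z)) (suc (w + z))) xor a (suc (y + x)) (suc (w + x)) ∎
  where
  open ≡-Reasoning
  w N : ℕ
  w = x + y + z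
  N = 2 * suc w ∸ 1
  index : ∀ {a b c} → a ≡ b + c → a ∸ b + 1 ≡ suc c
  index {b = b} {c} a≡b+c = trans (cong (_+ 1) (∸-≡ b a≡b+c)) (ℕP.+-comm c 1)
  identity₁ : ∀ x y z → x + y + z + suc x ≡ suc (x + y) + (x + z)
  identity₁ = ℕSolver.solve-∀
  identity₂ : ∀ x y z → x + y + z + suc (x + y + z + 0) ≡ suc (x + y) + (x + y + z + z)
  identity₂ = ℕSolver.solve-∀
  identity₃ : ∀ x y z → x + y + z + z ≡ x + z + (z + y)
  identity₃ = ℕSolver.solve-∀
  identity₄ : ∀ x y z → x + y + z + suc (x + y + z + 0) ≡ suc (x + z) + (x + y + z + y)
  identity₄ = ℕSolver.solve-∀

cyclicSum : (ℕ → ℕ → Bool) → ℕ → ℕ → ℕ → Bool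
cyclicSum g x y z = (g z y xor g x z) xor g y x

γρ∇-coords : ∀ S g x y z → let w = x + y + z in
  (∀ p q → p ≤ w → ∇ S (suc (p + q)) (suc (w + q)) ≡ g p q) →
  coords (γ (suc w) (ρ (2 * suc w ∸ 1) (∇ S))) x y z ≡ cyclicSum g x y z
γρ∇-coords S g x y z entry = trans (γρ-coords (∇ S) x y z)
  (cong₂ _xor_ (cong₂ _xor_ (entry z y (ℕP.m≤n+m z (x + y))) (entry x z (ℕP.≤-trans (ℕP.m≤m+n x y) (ℕP.m≤m+n (x + y) z))))
               (entry y x (ℕP.≤-trans (ℕP.m≤n+m y x) (ℕP.m≤m+n (x + y) z))))

-- If g is symmetric and satisfies g(p, q+1) = g(p+1, q+1) + g(p+1, q), then its cyclic sum
-- is a symmetric Pascal function: each of the three terms of Pascal's rule for the cyclic sum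
-- is one instance of the rule for g.
cyclicSum-symPascal : ∀ {n g} → (∀ p q → g p q ≡ g q p) →
                      (∀ p q → g p (suc q) ≡ g (suc p) (suc q) xor g (suc p) q) → IsSymPascal n (cyclicSum g)
cyclicSum-symPascal {g = g} sym-g rule = record
  { swap = λ x y z _ → begin
      (g z y xor g x z) xor g y x   ≡⟨ cong₂ _xor_ (cong₂ _xor_ (sym-g z y) (sym-g x z)) (sym-g y x) ⟩
      (g y z xor g z x) xor g x y   ≡⟨ cong (_xor g x y) (xor-comm (g y z) (g z x)) ⟩
      (g z x xor g y z) xor g x y   ∎
  ; rotate = λ x y z _ → 𝔽₂.solve 3 (λ a b c → (a :+ b) :+ c := (c :+ a) :+ b) refl (g z y) (g x z) (g y x)
  ; pascal = λ x y z _ → begin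
      (g z (suc y) xor g (suc x) z) xor g (suc y) (suc x)
        ≡⟨ cong₂ _xor_ (cong₂ _xor_ (rule z y) (solvedʳ (rule x z))) (solvedˡ (rule y x)) ⟩
      ((g (suc z) (suc y) xor g (suc z) y) xor (g x (suc z) xor g (suc x) (suc z))) xor (g y (suc x) xor g (suc y) x)
        ≡⟨ 𝔽₂.solve 6 (λ a b c d e f → ((a :+ b) :+ (c :+ d)) :+ (e :+ f) := ((a :+ c) :+ f) :+ ((b :+ d) :+ e)) refl
             (g (suc z) (suc y)) (g (suc z) y) (g x (suc z)) (g (suc x) (suc z)) (g y (suc x)) (g (suc y) x) ⟩
      ((g (suc z) (suc y) xor g x (suc z)) xor g (suc y) x) xor ((g (suc z) y xor g (suc x) (suc z)) xor g y (suc x)) ∎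
  }
  where
  open ≡-Reasoning
  open 𝔽₂ using (_:+_; _:=_)
  solvedˡ : ∀ {a b c : Bool} → a ≡ b xor c → b ≡ a xor c
  solvedˡ {b = b} {c} refl = 𝔽₂.solve 2 (λ b c → b := (b :+ c) :+ c) refl b c
  solvedʳ : ∀ {a b c : Bool} → a ≡ b xor c → c ≡ a xor b
  solvedʳ {b = b} {c} refl = 𝔽₂.solve 2 (λ b c → c := (b :+ c) :+ b) refl b c

∇-ones : ∀ i j → ∇ (const true) i j ≡ (i ≡ᵇ 1)
∇-ones zero j = refl
∇-ones (suc zero) j = refl
∇-ones (suc (suc zero)) j = refl
∇-ones (suc (suc (suc i))) j = cong₂ _xor_ (∇-ones (suc (suc i)) (j ∸ 1)) (∇-ones (suc (suc i)) j)

∇-binomial : ∀ K l i j → i ≤ j → ∇ (B K l) (suc i) j ≡ binom₂ (l ℤ.+ + j ℤ.- + suc i) (+ K ℤ.- + i)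
∇-binomial K l zero j _ = cong (binom₂ (l ℤ.+ + j ℤ.- + 1)) (sym (ℤP.+-identityʳ (+ K)))
∇-binomial K l (suc i) (suc j) (s≤s i≤j) = begin
  ∇ (B K l) (suc i) j xor ∇ (B K l) (suc i) (suc j)
    ≡⟨ cong₂ _xor_ (∇-binomial K l i j i≤j) (∇-binomial K l i (suc j) (ℕP.m≤n⇒m≤1+n i≤j)) ⟩
  binom₂ (l ℤ.+ + j ℤ.- + suc i) (+ K ℤ.- + i) xor binom₂ (l ℤ.+ + suc j ℤ.- + suc i) (+ K ℤ.- + i)
    ≡⟨ cong₂ _xor_ (cong (binom₂ a) (identity₁ (+ K) (+ i))) (cong₂ binom₂ (identity₂ l (+ j) (+ i)) (identity₁ (+ K) (+ i))) ⟩
  binom₂ a (b ℤ.+ + 1) xor binom₂ (a ℤ.+ + 1) (b ℤ.+ + 1)     ≡⟨ pascal⁻¹ (binom₂-pascal a b) ⟩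
  binom₂ a b                                                  ≡⟨ cong (λ t → binom₂ t b) (identity₃ l (+ j) (+ i)) ⟨
  binom₂ (l ℤ.+ + suc j ℤ.- + suc (suc i)) b                  ∎
  where
  open ≡-Reasoning
  a b : ℤ
  a = l ℤ.+ + j ℤ.- + suc i
  b = + K ℤ.- + suc i
  pascal⁻¹ : ∀ {p q r : Bool} → r ≡ p xor q → q xor r ≡ p
  pascal⁻¹ {p} {q} refl = 𝔽₂.solve 2 (λ p q → q 𝔽₂.:+ (p 𝔽₂.:+ q) 𝔽₂.:= p) refl p q
  identity₁ : ∀ K I → K ℤ.- I ≡ K ℤ.- (+ 1 ℤ.+ I) ℤ.+ + 1
  identity₁ = ℤSolver.solve-∀
  identity₂ : ∀ L J I → L ℤ.+ (+ 1 ℤ.+ J) ℤ.- (+ 1 ℤ.+ I) ≡ L ℤ.+ J ℤ.- (+ 1 ℤ.+ I) ℤ.+ + 1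
  identity₂ = ℤSolver.solve-∀
  identity₃ : ∀ L J I → L ℤ.+ (+ 1 ℤ.+ J) ℤ.- (+ 1 ℤ.+ (+ 1 ℤ.+ I)) ≡ L ℤ.+ J ℤ.- (+ 1 ℤ.+ I)
  identity₃ = ℤSolver.solve-∀

-- The first vector γ(U_{2n-1}): the cyclic sum of the indicator of p + q = 0, i.e. 1 exactly
-- at the three corners of the triangle.
corner : ℕ → ℕ → Bool
corner p q = p + q ≡ᵇ 0

corner-symPascal : ∀ {n} → IsSymPascal n (cyclicSum corner)
corner-symPascal = cyclicSum-symPascal (λ p q → cong (_≡ᵇ 0) (ℕP.+-comm p q)) rule
  where
  rule : ∀ p q → corner p (suc q) ≡ corner (suc p) (suc q) xor corner (suc p) q
  rule p q = cong (_≡ᵇ 0) (ℕP.+-suc p q)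

family₀-coords : ∀ n → coords (family n 0) ≗[ n ] cyclicSum corner
family₀-coords .(suc (x + y + z)) x y z refl = γρ∇-coords (const true) corner x y z (λ p q _ → ∇-ones (suc (p + q)) _)

T : ℕ → ℕ → ℕ → Bool
T k p q = binom₂ (+ k ℤ.- + p) (+ (2 * k) ℤ.+ + 1 ℤ.- + p ℤ.- + q)

2k≡k+k : ∀ k → + (2 * k) ≡ + k ℤ.+ + k
2k≡k+k k = trans (cong (λ t → + (k + t)) (ℕP.+-identityʳ k)) (ℤP.pos-+ k k)

-- T_k is symmetric, by upper negation.
T-sym : ∀ k p q → T k p q ≡ T k q p
T-sym k p q = trans (binom₂-upperNeg (+ k ℤ.- + p) (+ (2 * k) ℤ.+ + 1 ℤ.- + p ℤ.- + q)) (cong₂ binom₂ upper lower)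
  where
  upper : + (2 * k) ℤ.+ + 1 ℤ.- + p ℤ.- + q ℤ.- (+ k ℤ.- + p) ℤ.- + 1 ≡ + k ℤ.- + q
  upper = trans (cong (λ t → t ℤ.+ + 1 ℤ.- + p ℤ.- + q ℤ.- (+ k ℤ.- + p) ℤ.- + 1) (2k≡k+k k)) (identity (+ k) (+ p) (+ q))
    where
    identity : ∀ k p q → k ℤ.+ k ℤ.+ + 1 ℤ.- p ℤ.- q ℤ.- (k ℤ.- p) ℤ.- + 1 ≡ k ℤ.- q
    identity = ℤSolver.solve-∀
  lower : + (2 * k) ℤ.+ + 1 ℤ.- + p ℤ.- + q ≡ + (2 * k) ℤ.+ + 1 ℤ.- + q ℤ.- + p
  lower = identity (+ (2 * k)) (+ p) (+ q)
    where
    identity : ∀ K p q → K ℤ.+ + 1 ℤ.- p ℤ.- q ≡ K ℤ.+ + 1 ℤ.- q ℤ.- p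
    identity = ℤSolver.solve-∀

-- T_k(p, q+1) = T_k(p+1, q+1) + T_k(p+1, q) is Pascal's rule C(a+1, b+1) = C(a, b) + C(a, b+1)
-- for a = k - p - 1 and b = 2k - p - q - 1.
T-rule : ∀ k p q → T k p (suc q) ≡ T k (suc p) (suc q) xor T k (suc p) q
T-rule k p q = trans (cong₂ binom₂ (identity₁ (+ k) (+ p)) (identity₂ (+ (2 * k)) (+ p) (+ q)))
                     (trans (binom₂-pascal a b) (cong (binom₂ a b xor_) (cong (binom₂ a) (identity₃ (+ (2 * k)) (+ p) (+ q)))))
  where
  a b : ℤ
  a = + k ℤ.- + suc p
  b = + (2 * k) ℤ.+ + 1 ℤ.- + suc p ℤ.- + suc q
  identity₁ : ∀ k p → k ℤ.- p ≡ k ℤ.- (+ 1 ℤ.+ p) ℤ.+ + 1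
  identity₁ = ℤSolver.solve-∀
  identity₂ : ∀ K p q → K ℤ.+ + 1 ℤ.- p ℤ.- (+ 1 ℤ.+ q) ≡ K ℤ.+ + 1 ℤ.- (+ 1 ℤ.+ p) ℤ.- (+ 1 ℤ.+ q) ℤ.+ + 1
  identity₂ = ℤSolver.solve-∀
  identity₃ : ∀ K p q → K ℤ.+ + 1 ℤ.- (+ 1 ℤ.+ p) ℤ.- (+ 1 ℤ.+ q) ℤ.+ + 1 ≡ K ℤ.+ + 1 ℤ.- (+ 1 ℤ.+ p) ℤ.- q
  identity₃ = ℤSolver.solve-∀

T-symPascal : ∀ {n} k → IsSymPascal n (cyclicSum (T k))
T-symPascal k = cyclicSum-symPascal (T-sym k) (T-rule k)

gen-coords : ∀ n k → coords (gen n k) ≗[ n ] cyclicSum (T k)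
gen-coords .(suc (x + y + z)) k x y z refl = γρ∇-coords (B (2 * k + 1) l) (T k) x y z entry
  where
  w : ℕ
  w = x + y + z
  l : ℤ
  l = + k ℤ.- + suc w ℤ.+ + 1
  entry : ∀ p q → p ≤ w → ∇ (B (2 * k + 1) l) (suc (p + q)) (suc (w + q)) ≡ T k p q
  entry p q p≤w = trans (∇-binomial (2 * k + 1) l (p + q) (suc (w + q)) (ℕP.m≤n⇒m≤1+n (ℕP.+-monoˡ-≤ q p≤w)))
                        (cong₂ binom₂ upper lower)
    where
    upper : l ℤ.+ + suc (w + q) ℤ.- + suc (p + q) ≡ + k ℤ.- + p
    upper = trans (cong₂ (λ s t → + k ℤ.- (+ 1 ℤ.+ + w) ℤ.+ + 1 ℤ.+ (+ 1 ℤ.+ s) ℤ.- (+ 1 ℤ.+ t)) (ℤP.pos-+ w q) (ℤP.pos-+ p q))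
                  (identity (+ k) (+ w) (+ p) (+ q))
      where
      identity : ∀ k w p q → k ℤ.- (+ 1 ℤ.+ w) ℤ.+ + 1 ℤ.+ (+ 1 ℤ.+ (w ℤ.+ q)) ℤ.- (+ 1 ℤ.+ (p ℤ.+ q)) ≡ k ℤ.- p
      identity = ℤSolver.solve-∀
    lower : + (2 * k + 1) ℤ.- + (p + q) ≡ + (2 * k) ℤ.+ + 1 ℤ.- + p ℤ.- + q
    lower = trans (cong₂ ℤ._-_ (ℤP.pos-+ (2 * k) 1) (ℤP.pos-+ p q)) (identity (+ (2 * k)) (+ p) (+ q))
      where
      identity : ∀ K p q → K ℤ.+ + 1 ℤ.- (p ℤ.+ q) ≡ K ℤ.+ + 1 ℤ.- p ℤ.- q
      identity = ℤSolver.solve-∀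

explicit-coords : ∀ n k → coords (explicit n k) ≗[ n ] cyclicSum (T k)
explicit-coords .(suc (x + y + z)) k x y z refl = begin
  mod2 ((b₁ ℤ.+ b₂) ℤ.+ b₃)                                         ≡⟨ mod2-+ (b₁ ℤ.+ b₂) b₃ ⟩
  mod2 (b₁ ℤ.+ b₂) xor mod2 b₃                                      ≡⟨ cong (_xor mod2 b₃) (mod2-+ b₁ b₂) ⟩
  (mod2 b₁ xor mod2 b₂) xor mod2 b₃
    ≡⟨ cong₂ _xor_ (cong₂ _xor_ (cong₂ binom₂ upper₁ lower₁) (cong₂ binom₂ upper₂ lower₂)) (cong₂ binom₂ upper₃ lower₃) ⟩
  (T k y x xor T k x z) xor T k z y
    ≡⟨ 𝔽₂.solve 3 (λ a b c → (a :+ b) :+ c := (c :+ b) :+ a) refl (T k y x) (T k x z) (T k z y) ⟩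
  (T k z y xor T k x z) xor T k y x                                 ∎
  where
  open ≡-Reasoning
  open 𝔽₂ using (_:+_; _:=_)
  n i j : ℕ
  n = suc (x + y + z)
  i = suc (x + y)
  j = suc x
  b₁ b₂ b₃ X Y Z K : ℤ
  b₁ = binomℤ (+ k ℤ.+ + j ℤ.- + i) (+ (2 * k) ℤ.- + i ℤ.+ + 2)
  b₂ = binomℤ (+ k ℤ.- + j ℤ.+ + 1) (+ i ℤ.- + j ℤ.+ + (2 * k) ℤ.- + n ℤ.+ + 2)
  b₃ = binomℤ (+ k ℤ.- + n ℤ.+ + i) (+ (2 * k) ℤ.+ + j ℤ.- + n ℤ.+ + 1)
  X = + x
  Y = + y
  Z = + z
  K = + (2 * k)
  n≡ : + n ≡ + 1 ℤ.+ (X ℤ.+ Y ℤ.+ Z)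
  n≡ = cong (ℤ._+_ (+ 1)) (trans (ℤP.pos-+ (x + y) z) (cong (ℤ._+ Z) (ℤP.pos-+ x y)))
  i≡ : + i ≡ + 1 ℤ.+ (X ℤ.+ Y)
  i≡ = cong (ℤ._+_ (+ 1)) (ℤP.pos-+ x y)
  upper₁ : + k ℤ.+ + j ℤ.- + i ≡ + k ℤ.- Y
  upper₁ = trans (cong (λ t → + k ℤ.+ (+ 1 ℤ.+ X) ℤ.- t) i≡) (identity (+ k) X Y)
    where
    identity : ∀ k x y → k ℤ.+ (+ 1 ℤ.+ x) ℤ.- (+ 1 ℤ.+ (x ℤ.+ y)) ≡ k ℤ.- y
    identity = ℤSolver.solve-∀
  lower₁ : K ℤ.- + i ℤ.+ + 2 ≡ K ℤ.+ + 1 ℤ.- Y ℤ.- X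
  lower₁ = trans (cong (λ t → K ℤ.- t ℤ.+ + 2) i≡) (identity K X Y)
    where
    identity : ∀ K x y → K ℤ.- (+ 1 ℤ.+ (x ℤ.+ y)) ℤ.+ + 2 ≡ K ℤ.+ + 1 ℤ.- y ℤ.- x
    identity = ℤSolver.solve-∀
  upper₂ : + k ℤ.- + j ℤ.+ + 1 ≡ + k ℤ.- X
  upper₂ = identity (+ k) X
    where
    identity : ∀ k x → k ℤ.- (+ 1 ℤ.+ x) ℤ.+ + 1 ≡ k ℤ.- x
    identity = ℤSolver.solve-∀
  lower₂ : + i ℤ.- + j ℤ.+ K ℤ.- + n ℤ.+ + 2 ≡ K ℤ.+ + 1 ℤ.- X ℤ.- Z
  lower₂ = trans (cong₂ (λ s t → s ℤ.- (+ 1 ℤ.+ X) ℤ.+ K ℤ.- t ℤ.+ + 2) i≡ n≡) (identity K X Y Z)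
    where
    identity : ∀ K x y z → (+ 1 ℤ.+ (x ℤ.+ y)) ℤ.- (+ 1 ℤ.+ x) ℤ.+ K ℤ.- (+ 1 ℤ.+ (x ℤ.+ y ℤ.+ z)) ℤ.+ + 2 ≡ K ℤ.+ + 1 ℤ.- x ℤ.- z
    identity = ℤSolver.solve-∀
  upper₃ : + k ℤ.- + n ℤ.+ + i ≡ + k ℤ.- Z
  upper₃ = trans (cong₂ (λ s t → + k ℤ.- s ℤ.+ t) n≡ i≡) (identity (+ k) X Y Z)
    where
    identity : ∀ k x y z → k ℤ.- (+ 1 ℤ.+ (x ℤ.+ y ℤ.+ z)) ℤ.+ (+ 1 ℤ.+ (x ℤ.+ y)) ≡ k ℤ.- z
    identity = ℤSolver.solve-∀
  lower₃ : K ℤ.+ + j ℤ.- + n ℤ.+ + 1 ≡ K ℤ.+ + 1 ℤ.- Z ℤ.- Y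
  lower₃ = trans (cong (λ t → K ℤ.+ (+ 1 ℤ.+ X) ℤ.- t ℤ.+ + 1) n≡) (identity K X Y Z)
    where
    identity : ∀ K x y z → K ℤ.+ (+ 1 ℤ.+ x) ℤ.- (+ 1 ℤ.+ (x ℤ.+ y ℤ.+ z)) ℤ.+ + 1 ≡ K ℤ.+ + 1 ℤ.- z ℤ.- y
    identity = ℤSolver.solve-∀

-- T_k(u, v) = 0 when the lower index 2k + 1 - u - v is negative.
T-negative : ∀ k u v → suc (suc (2 * k)) ≤ u + v → T k u v ≡ false
T-negative k u v 2k+2≤u+v = cong (binom₂ (+ k ℤ.- + u)) (begin
  + (2 * k) ℤ.+ + 1 ℤ.- + u ℤ.- + v                   ≡⟨ identity₁ (+ (2 * k)) (+ u) (+ v) ⟩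
  + (2 * k) ℤ.+ + 1 ℤ.- (+ u ℤ.+ + v)
    ≡⟨ cong (λ t → + (2 * k) ℤ.+ + 1 ℤ.- t) (trans (sym (ℤP.pos-+ u v)) (cong +_ (sym u+v≡))) ⟩
  + (2 * k) ℤ.+ + 1 ℤ.- + (suc (suc (2 * k)) + d)     ≡⟨ cong (λ t → + (2 * k) ℤ.+ + 1 ℤ.- t) (ℤP.pos-+ (suc (suc (2 * k))) d) ⟩
  + (2 * k) ℤ.+ + 1 ℤ.- (+ 1 ℤ.+ (+ 1 ℤ.+ + (2 * k)) ℤ.+ + d) ≡⟨ identity₂ (+ (2 * k)) (+ d) ⟩
  -[1+ d ]                                            ∎)
  where
  open ≡-Reasoning
  d : ℕ
  d = proj₁ (ℕP.m≤n⇒∃[o]m+o≡n 2k+2≤u+v)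
  u+v≡ : suc (suc (2 * k)) + d ≡ u + v
  u+v≡ = proj₂ (ℕP.m≤n⇒∃[o]m+o≡n 2k+2≤u+v)
  identity₁ : ∀ K u v → K ℤ.+ + 1 ℤ.- u ℤ.- v ≡ K ℤ.+ + 1 ℤ.- (u ℤ.+ v)
  identity₁ = ℤSolver.solve-∀
  identity₂ : ∀ K d → K ℤ.+ + 1 ℤ.- (+ 1 ℤ.+ (+ 1 ℤ.+ K) ℤ.+ d) ≡ ℤ.- (+ 1 ℤ.+ d)
  identity₂ = ℤSolver.solve-∀

-- On the edge v = 0: T_k(y, 0) = C(k, 2k + 1 - y) vanishes for y ≤ k ...
T-edge-zero : ∀ k y → y ≤ k → T k y 0 ≡ false
T-edge-zero k y y≤k = begin
  T k y 0                        ≡⟨ T-sym k y 0 ⟩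
  binom₂ (+ k ℤ.- + 0) lower     ≡⟨ cong₂ binom₂ (ℤP.+-identityʳ (+ k)) lower≡ ⟩
  binom₂ (+ k) (+ suc (k + e))   ≡⟨ binom₂-pos k (suc (k + e)) ⟩
  binomBit k (suc (k + e))       ≡⟨ binomBit-< (s≤s (ℕP.m≤m+n k e)) ⟩
  false                          ∎
  where
  open ≡-Reasoning
  e : ℕ
  e = proj₁ (ℕP.m≤n⇒∃[o]m+o≡n y≤k)
  k≡y+e : k ≡ y + e
  k≡y+e = sym (proj₂ (ℕP.m≤n⇒∃[o]m+o≡n y≤k))
  lower : ℤ
  lower = + (2 * k) ℤ.+ + 1 ℤ.- + 0 ℤ.- + y
  lower≡ : lower ≡ + suc (k + e)
  lower≡ = begin
    + (2 * k) ℤ.+ + 1 ℤ.- + 0 ℤ.- + y        ≡⟨ cong (λ t → t ℤ.+ + 1 ℤ.- + 0 ℤ.- + y) (2k≡k+k k) ⟩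
    + k ℤ.+ + k ℤ.+ + 1 ℤ.- + 0 ℤ.- + y      ≡⟨ cong (λ t → + k ℤ.+ t ℤ.+ + 1 ℤ.- + 0 ℤ.- + y) (trans (cong +_ k≡y+e) (ℤP.pos-+ y e)) ⟩
    + k ℤ.+ (+ y ℤ.+ + e) ℤ.+ + 1 ℤ.- + 0 ℤ.- + y ≡⟨ identity (+ k) (+ y) (+ e) ⟩
    + 1 ℤ.+ (+ k ℤ.+ + e)                    ≡⟨ cong (ℤ._+_ (+ 1)) (ℤP.pos-+ k e) ⟨
    + suc (k + e)                            ∎
    where
    identity : ∀ k y e → k ℤ.+ (y ℤ.+ e) ℤ.+ + 1 ℤ.- + 0 ℤ.- y ≡ + 1 ℤ.+ (k ℤ.+ e)
    identity = ℤSolver.solve-∀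

-- ... and T_k(k + 1, 0) = C(-1, k) = 1.
T-edge-pivot : ∀ k → T k (suc k) 0 ≡ true
T-edge-pivot k = begin
  T k (suc k) 0
    ≡⟨ cong₂ binom₂ (identity₁ (+ k)) (trans (cong (λ t → t ℤ.+ + 1 ℤ.- + suc k ℤ.- + 0) (2k≡k+k k)) (identity₂ (+ k))) ⟩
  binom₂ -[1+ 0 ] (+ k)          ≡⟨ binom₂-neg 0 k ⟩
  binomBit k k                   ≡⟨ binomBit-diag k ⟩
  true                           ∎
  where
  open ≡-Reasoning
  identity₁ : ∀ k → k ℤ.- (+ 1 ℤ.+ k) ≡ ℤ.- (+ 1)
  identity₁ = ℤSolver.solve-∀
  identity₂ : ∀ k → k ℤ.+ k ℤ.+ + 1 ℤ.- (+ 1 ℤ.+ k) ℤ.- + 0 ≡ k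
  identity₂ = ℤSolver.solve-∀

cyclicT-left : ∀ k y z → 3 * k + 3 ≤ y + z → y ≤ suc k → cyclicSum (T k) 0 y z ≡ T k y 0
cyclicT-left k y z large y≤k+1 =
  cong (_xor T k y 0) (cong₂ _xor_ (T-negative k z y (ℕP.≤-trans 2k+2≤z (ℕP.m≤m+n z y))) (T-negative k 0 z 2k+2≤z))
  where
  2k+2≤z : suc (suc (2 * k)) ≤ z
  2k+2≤z = ℕP.+-cancelʳ-≤ (suc k) _ z (begin
    suc (suc (2 * k)) + suc k   ≡⟨ identity k ⟩
    3 * k + 3                   ≤⟨ large ⟩
    y + z                       ≤⟨ ℕP.+-monoˡ-≤ z y≤k+1 ⟩
    suc k + z                   ≡⟨ ℕP.+-comm (suc k) z ⟩
    z + suc k                   ∎)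
    where
    open ℕP.≤-Reasoning
    identity : ∀ k → suc (suc (2 * k)) + suc k ≡ 3 * k + 3
    identity = ℕSolver.solve-∀

n≤3m : ∀ n → n ≤ 3 * ceil/3 n
n≤3m n = ℕP.+-cancelˡ-≤ 2 n (3 * q) (begin
  2 + n          ≡⟨ ℕP.+-comm 2 n ⟩
  n + 2          ≡⟨ m≡m%n+[m/n]*n (n + 2) 3 ⟩
  rem + q * 3    ≤⟨ ℕP.+-monoˡ-≤ (q * 3) (ℕP.<⇒≤pred (m%n<n (n + 2) 3)) ⟩
  2 + q * 3      ≡⟨ cong (λ t → 2 + t) (ℕP.*-comm q 3) ⟩
  2 + 3 * q      ∎)
  where
  open ℕP.≤-Reasoning
  q rem : ℕ
  q = ceil/3 n
  rem = (n + 2) % 3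

3m≤n+2 : ∀ n → 3 * ceil/3 n ≤ n + 2
3m≤n+2 n = subst (_≤ n + 2) (ℕP.*-comm (ceil/3 n) 3) (m/n*n≤m (n + 2) 3)

m≤n : ∀ n → ceil/3 n ≤ n
m≤n zero = z≤n
m≤n n@(suc _) = ℕP.*-cancelˡ-≤ 3 (begin
  3 * ceil/3 n   ≤⟨ 3m≤n+2 n ⟩
  n + 2          ≤⟨ ℕP.+-monoʳ-≤ n (ℕP.*-monoʳ-≤ 2 (s≤s z≤n)) ⟩
  n + 2 * n      ≡⟨ identity n ⟩
  3 * n          ∎)
  where
  open ℕP.≤-Reasoning
  identity : ∀ n → n + 2 * n ≡ 3 * n
  identity = ℕSolver.solve-∀

large : ∀ k w → suc (suc k) ≤ ceil/3 (suc w) → 3 * k + 3 ≤ w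
large k w k+2≤m = ℕP.+-cancelʳ-≤ 3 (3 * k + 3) w (begin
  3 * k + 3 + 3          ≡⟨ identity₁ k ⟩
  3 * suc (suc k)        ≤⟨ ℕP.*-monoʳ-≤ 3 k+2≤m ⟩
  3 * ceil/3 (suc w)     ≤⟨ 3m≤n+2 (suc w) ⟩
  suc w + 2              ≡⟨ identity₂ w ⟩
  w + 3                  ∎)
  where
  open ℕP.≤-Reasoning
  identity₁ : ∀ k → 3 * k + 3 + 3 ≡ 3 * suc (suc k)
  identity₁ = ℕSolver.solve-∀
  identity₂ : ∀ w → suc w + 2 ≡ w + 3
  identity₂ = ℕSolver.solve-∀

family-DPT : ∀ n s → IsDPT n (family n s)
family-DPT n zero = symPascal⇒DPT (family₀-coords n) corner-symPascal
family-DPT n (suc k) = symPascal⇒DPT (gen-coords n k) (T-symPascal k)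

leftPoint : ∀ {n y} → suc y ≤ n → Σ ℕ (λ z → suc (y + z) ≡ n)
leftPoint y<n = ℕP.m≤n⇒∃[o]m+o≡n y<n

gen-left : ∀ n k y z → suc (suc k) ≤ ceil/3 n → suc (y + z) ≡ n → y ≤ suc k → family n (suc k) (suc y) 1 ≡ T k y 0
gen-left n k y z k+2≤m n≡ y≤k+1 = trans (gen-coords n k 0 y z n≡)
  (cyclicT-left k y z (large k (y + z) (subst (λ t → suc (suc k) ≤ ceil/3 t) (sym n≡) k+2≤m)) y≤k+1)

corner-left : ∀ y z → cyclicSum corner 0 y z ≡ (y ≡ᵇ 0) ∨ (z ≡ᵇ 0)
corner-left zero z = trans (cong (λ t → ((t ≡ᵇ 0) xor (z ≡ᵇ 0)) xor true) (ℕP.+-identityʳ z)) (cong (_xor true) (xor-same (z ≡ᵇ 0)))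
corner-left (suc y) zero = refl
corner-left (suc y) (suc z) = refl

family-leading : ∀ n s → suc s ≤ ceil/3 n → LeadingZeros s (family n s)
family-leading n (suc k) k+2≤m (suc y) _ (s≤s y≤k) =
  trans (gen-left n k y z k+2≤m n≡ (ℕP.m≤n⇒m≤1+n y≤k)) (T-edge-zero k y y≤k)
  where
  onLeft : Σ ℕ (λ z → suc (y + z) ≡ n)
  onLeft = leftPoint (ℕP.≤-trans (s≤s (ℕP.m≤n⇒m≤1+n y≤k)) (ℕP.≤-trans k+2≤m (m≤n n)))
  z : ℕ
  z = proj₁ onLeft
  n≡ : suc (y + z) ≡ n
  n≡ = proj₂ onLeft

family-pivot : ∀ n s → suc s ≤ ceil/3 n → family n s (suc s) 1 ≡ true
family-pivot (suc w) zero _ = trans (family₀-coords (suc w) 0 0 w refl) (corner-left 0 w)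
family-pivot n (suc k) k+2≤m = trans (gen-left n k (suc k) z k+2≤m n≡ ℕP.≤-refl) (T-edge-pivot k)
  where
  onLeft : Σ ℕ (λ z → suc (suc k + z) ≡ n)
  onLeft = leftPoint (ℕP.≤-trans k+2≤m (m≤n n))
  z : ℕ
  z = proj₁ onLeft
  n≡ : suc (suc k + z) ≡ n
  n≡ = proj₂ onLeft

side-ends : ∀ y z → side (suc (y + z)) (suc y) ≡ (y ≡ᵇ 0) ∨ (z ≡ᵇ 0)
side-ends y z = cong ((y ≡ᵇ 0) ∨_) (≡ᵇ-+ y z)
  where
  ≡ᵇ-+ : ∀ a b → (a ≡ᵇ a + b) ≡ (b ≡ᵇ 0)
  ≡ᵇ-+ zero zero = refl
  ≡ᵇ-+ zero (suc b) = refl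
  ≡ᵇ-+ (suc a) b = ≡ᵇ-+ a b

family₀-sides : ∀ n i → 1 ≤ i → i ≤ n → (family n 0 i 1 ≡ side n i) × (family n 0 i i ≡ side n i)
family₀-sides n (suc y) _ i≤n = left , right
  where
  onLeft : Σ ℕ (λ z → suc (y + z) ≡ n)
  onLeft = leftPoint i≤n
  z : ℕ
  z = proj₁ onLeft
  n≡ : suc (y + z) ≡ n
  n≡ = proj₂ onLeft
  ends : cyclicSum corner 0 y z ≡ side n (suc y)
  ends = trans (corner-left y z) (trans (sym (side-ends y z)) (cong (λ t → side t (suc y)) n≡))
  left : family n 0 (suc y) 1 ≡ side n (suc y)
  left = trans (family₀-coords n 0 y z n≡) ends
  right : family n 0 (suc y) (suc y) ≡ side n (suc y)
  right = begin
    family n 0 (suc y) (suc y)      ≡⟨ cong (λ t → family n 0 (suc t) (suc y)) (ℕP.+-identityʳ y) ⟨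
    coords (family n 0) y 0 z       ≡⟨ family₀-coords n y 0 z n≡′ ⟩
    cyclicSum corner y 0 z          ≡⟨ IsSymPascal.swap (corner-symPascal {n}) y 0 z n≡′ ⟩
    cyclicSum corner 0 y z          ≡⟨ ends ⟩
    side n (suc y)                  ∎
    where
    open ≡-Reasoning
    n≡′ : suc (y + 0 + z) ≡ n
    n≡′ = trans (cong (λ t → suc (t + z)) (ℕP.+-identityʳ y)) n≡

gen≈explicit : ∀ n k → gen n k ≈[ n ] explicit n k
gen≈explicit n k = ≈-fromCoords λ x y z n≡ → trans (gen-coords n k x y z n≡) (sym (explicit-coords n k x y z n≡))

mainTheorem16 : (n : ℕ) → 1 ≤ n →
    IsBasis n (IsDPT n) {ceil/3 n} (λ (t : Fin (ceil/3 n)) → family n (toℕ t))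
    × ((∀ i → 1 ≤ i → i ≤ n →
          (family n 0 i 1 ≡ side n i) × (family n 0 i i ≡ side n i))
    × (∀ k → k + 2 ≤ ceil/3 n → gen n k ≈[ n ] explicit n k))
mainTheorem16 n _ = basis , family₀-sides n , λ k _ → gen≈explicit n k
  where
  m : ℕ
  m = ceil/3 n
  basis : IsBasis n (IsDPT n) (λ (t : Fin m) → family n (toℕ t))
  basis = Echelon.basis (λ t → family n (toℕ t)) DPT-⊕
    (λ t → family-DPT n (toℕ t))
    (λ t → family-leading n (toℕ t) (FinP.toℕ<n t))
    (λ t → family-pivot n (toℕ t) (FinP.toℕ<n t))
    (m≤n n)
    (λ a∈DPT zeros → DPT-rigid a∈DPT (n≤3m n) zeros)
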